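{- The systems $\mathcal{D}$ and $\mathcal{K}$ are equivalent: a sequent $\Gamma\vdash G$ has a proof in $\mathcal{D}$ if and only if it has a proof in $\mathcal{K}$.
   Context: Propositions are first-order formulas built from atomic propositions $P(t_1,\dots,t_k)$ (predicate symbol applied to terms; $\top,\bot$ are not atomic), $\top$, $\bot$, $\wedge$, $\vee$, $\Rightarrow$, $\forall$, $\exists$. Sequents are $\Gamma\vdash G$ with $\Gamma$ a finite multiset of propositions and $G$ a proposition; $t$ below ranges over arbitrary terms. Common rules of $\mathcal{K}$ and $\mathcal{D}$: axiom $\Gamma,P\vdash P$ ($P$ atomic); $\top$-right $\Gamma\vdash\top$; $\bot$-left $\Gamma,\bot\vdash G$; $\wedge$-left (from $\Gamma,A,B\vdash G$ infer $\Gamma,A\wedge B\vdash G$); $\wedge$-right (from $\Gamma\vdash A$, $\Gamma\vdash B$ infer $\Gamma\vdash A\wedge B$); $\vee$-left (from $\Gamma,A\vdash G$, $\Gamma,B\vdash G$ infer $\Gamma,A\vee B\vdash G$); $\vee$-right (from $\Gamma\vdash A$, or from $\Gamma\vdash B$, infer $\Gamma\vdash A\vee B$); $\Rightarrow$-right (from $\Gamma,A\vdash B$ infer $\Gamma\vdash A\Rightarrow B$); $\forall$-right (from $\Gamma\vdash A$ infer $\Gamma\vdash\forall x\,A$, $x$ not free in $\Gamma$); contr-$\forall$-left (from $\Gamma,\forall x\,A,(t/x)A\vdash G$ infer $\Gamma,\forall x\,A\vdash G$); $\exists$-left (from $\Gamma,A\vdash G$ infer $\Gamma,\exists x\,A\vdash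 G$, $x$ not free in $\Gamma,G$); $\exists$-right (from $\Gamma\vdash(t/x)A$ infer $\Gamma\vdash\exists x\,A$). $\mathcal{K}$ consists of these rules plus contr-$\Rightarrow$-left (from $\Gamma,A\Rightarrow B\vdash A$ and $\Gamma,B\vdash G$ infer $\Gamma,A\Rightarrow B\vdash G$). $\mathcal{D}$ consists of the common rules plus: $\Rightarrow$-left$_{axiom}$ (from $\Gamma,P,B\vdash G$ infer $\Gamma,P,P\Rightarrow B\vdash G$, $P$ atomic); $\Rightarrow$-left$_\top$ (from $\Gamma,B\vdash G$ infer $\Gamma,\top\Rightarrow B\vdash G$); $\Rightarrow$-left$_\wedge$ (from $\Gamma,C\Rightarrow B\vdash C$, $\Gamma,D\Rightarrow B\vdash D$, $\Gamma,B\vdash G$ infer $\Gamma,(C\wedge D)\Rightarrow B\vdash G$); two $\Rightarrow$-left$_\vee$ rules (from $\Gamma,C\Rightarrow B,D\Rightarrow B\vdash C$ and $\Gamma,B\vdash G$, resp. from $\Gamma,C\Rightarrow B,D\Rightarrow B\vdash D$ and $\Gamma,B\vdash G$, infer $\Gamma,(C\vee D)\Rightarrow B\vdash G$); $\Rightarrow$-left$_\Rightarrow$ (from $\Gamma,D\Rightarrow B,C\vdash D$ and $\Gamma,B\vdash G$ infer $\Gamma,(C\Rightarrow D)\Rightarrow B\vdash G$); $\Rightarrow$-left$_\forall$ (from $\Gamma,(\forall x\,C)\Rightarrow B\vdash C$ and $\Gamma,B\vdash G$ infer $\Gamma,(\forall x\,C)\Rightarrow B\vdash G$, $x$ not free in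 $\Gamma,B$); $\Rightarrow$-left$_\exists$ (from $\Gamma,(\exists x\,C)\Rightarrow B\vdash(t/x)C$ and $\Gamma,B\vdash G$ infer $\Gamma,(\exists x\,C)\Rightarrow B\vdash G$). -}

module Defs where

open import Data.Nat using (ℕ; zero; suc)
open import Data.List using (List; []; _∷_; map)
open import Data.List.Relation.Binary.Permutation.Propositional using (_↭_)

-- First-order terms, de Bruijn indices for variables.
-- Function and predicate symbols are named by natural numbers, of any arity.
data Term : Set where
  var : ℕ → Term
  fun : ℕ → List Term → Term

infixr 6 _⇒_
infixr 7 _∨_
infixr 8 _∧_

data Prop : Set where
  atom : ℕ → List Term → Prop
  ⊤ ⊥  : Prop
  _∧_ _∨_ _⇒_ : Prop → Prop → Prop
  ∀' ∃' : Prop → Prop              -- binder: variable 0 is the bound one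

mutual
  substT : (ℕ → Term) → Term → Term
  substT σ (var n)    = σ n
  substT σ (fun f ts) = fun f (substTs σ ts)

  substTs : (ℕ → Term) → List Term → List Term
  substTs σ []       = []
  substTs σ (t ∷ ts) = substT σ t ∷ substTs σ ts

shiftT : Term → Term
shiftT = substT (λ n → var (suc n))

exts : (ℕ → Term) → ℕ → Term
exts σ zero    = var zero
exts σ (suc n) = shiftT (σ n)

subst : (ℕ → Term) → Prop → Prop
subst σ (atom p ts) = atom p (substTs σ ts)
subst σ ⊤ = ⊤
subst σ ⊥ = ⊥
subst σ (A ∧ B) = subst σ A ∧ subst σ B
subst σ (A ∨ B) = subst σ A ∨ subst σ B
subst σ (A ⇒ B) = subst σ A ⇒ subst σ B
subst σ (∀' A) = ∀' (subst (exts σ) A)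
subst σ (∃' A) = ∃' (subst (exts σ) A)

shift : Prop → Prop
shift = subst (λ n → var (suc n))

-- (t/x)A where x is the variable bound by the enclosing quantifier (index 0)
_[_] : Prop → Term → Prop
A [ t ] = subst σ A
  where
  σ : ℕ → Term
  σ zero    = t
  σ (suc n) = var n

Ctx : Set
Ctx = List Prop

shiftCtx : Ctx → Ctx
shiftCtx = map shift

-- Contexts are multisets: lists up to permutation (rule `perm`).
-- "Γ , A" is written  A ∷ Γ.

data _⊢K_ : Ctx → Prop → Set where
  perm   : ∀ {Γ Δ G} → Γ ↭ Δ → Γ ⊢K G → Δ ⊢K G
  ax     : ∀ {Γ p ts} → (atom p ts ∷ Γ) ⊢K atom p ts
  ⊤R     : ∀ {Γ} → Γ ⊢K ⊤
  ⊥L     : ∀ {Γ G} → (⊥ ∷ Γ) ⊢K G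
  ∧L     : ∀ {Γ A B G} → (A ∷ B ∷ Γ) ⊢K G → ((A ∧ B) ∷ Γ) ⊢K G
  ∧R     : ∀ {Γ A B} → Γ ⊢K A → Γ ⊢K B → Γ ⊢K (A ∧ B)
  ∨L     : ∀ {Γ A B G} → (A ∷ Γ) ⊢K G → (B ∷ Γ) ⊢K G → ((A ∨ B) ∷ Γ) ⊢K G
  ∨R₁    : ∀ {Γ A B} → Γ ⊢K A → Γ ⊢K (A ∨ B)
  ∨R₂    : ∀ {Γ A B} → Γ ⊢K B → Γ ⊢K (A ∨ B)
  ⇒R     : ∀ {Γ A B} → (A ∷ Γ) ⊢K B → Γ ⊢K (A ⇒ B)
  ∀R     : ∀ {Γ A} → shiftCtx Γ ⊢K A → Γ ⊢K ∀' A
  ∀L     : ∀ {Γ A G} (t : Term) → (A [ t ] ∷ ∀' A ∷ Γ) ⊢K G → (∀' A ∷ Γ) ⊢K G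
  ∃L     : ∀ {Γ A G} → (A ∷ shiftCtx Γ) ⊢K shift G → (∃' A ∷ Γ) ⊢K G
  ∃R     : ∀ {Γ A} (t : Term) → Γ ⊢K (A [ t ]) → Γ ⊢K ∃' A
  ⇒L     : ∀ {Γ A B G} → ((A ⇒ B) ∷ Γ) ⊢K A → (B ∷ Γ) ⊢K G → ((A ⇒ B) ∷ Γ) ⊢K G

data _⊢D_ : Ctx → Prop → Set where
  perm   : ∀ {Γ Δ G} → Γ ↭ Δ → Γ ⊢D G → Δ ⊢D G
  ax     : ∀ {Γ p ts} → (atom p ts ∷ Γ) ⊢D atom p ts
  ⊤R     : ∀ {Γ} → Γ ⊢D ⊤
  ⊥L     : ∀ {Γ G} → (⊥ ∷ Γ) ⊢D G
  ∧L     : ∀ {Γ A B G} → (A ∷ B ∷ Γ) ⊢D G → ((A ∧ B) ∷ Γ) ⊢D G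
  ∧R     : ∀ {Γ A B} → Γ ⊢D A → Γ ⊢D B → Γ ⊢D (A ∧ B)
  ∨L     : ∀ {Γ A B G} → (A ∷ Γ) ⊢D G → (B ∷ Γ) ⊢D G → ((A ∨ B) ∷ Γ) ⊢D G
  ∨R₁    : ∀ {Γ A B} → Γ ⊢D A → Γ ⊢D (A ∨ B)
  ∨R₂    : ∀ {Γ A B} → Γ ⊢D B → Γ ⊢D (A ∨ B)
  ⇒R     : ∀ {Γ A B} → (A ∷ Γ) ⊢D B → Γ ⊢D (A ⇒ B)
  ∀R     : ∀ {Γ A} → shiftCtx Γ ⊢D A → Γ ⊢D ∀' A
  ∀L     : ∀ {Γ A G} (t : Term) → (A [ t ] ∷ ∀' A ∷ Γ) ⊢D G → (∀' A ∷ Γ) ⊢D G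
  ∃L     : ∀ {Γ A G} → (A ∷ shiftCtx Γ) ⊢D shift G → (∃' A ∷ Γ) ⊢D G
  ∃R     : ∀ {Γ A} (t : Term) → Γ ⊢D (A [ t ]) → Γ ⊢D ∃' A
  ⇒Lax   : ∀ {Γ p ts B G} → (atom p ts ∷ B ∷ Γ) ⊢D G
           → (atom p ts ∷ (atom p ts ⇒ B) ∷ Γ) ⊢D G
  ⇒L⊤    : ∀ {Γ B G} → (B ∷ Γ) ⊢D G → ((⊤ ⇒ B) ∷ Γ) ⊢D G
  ⇒L∧    : ∀ {Γ C D B G} → ((C ⇒ B) ∷ Γ) ⊢D C → ((D ⇒ B) ∷ Γ) ⊢D D → (B ∷ Γ) ⊢D G
           → (((C ∧ D) ⇒ B) ∷ Γ) ⊢D G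
  ⇒L∨₁   : ∀ {Γ C D B G} → ((C ⇒ B) ∷ (D ⇒ B) ∷ Γ) ⊢D C → (B ∷ Γ) ⊢D G
           → (((C ∨ D) ⇒ B) ∷ Γ) ⊢D G
  ⇒L∨₂   : ∀ {Γ C D B G} → ((C ⇒ B) ∷ (D ⇒ B) ∷ Γ) ⊢D D → (B ∷ Γ) ⊢D G
           → (((C ∨ D) ⇒ B) ∷ Γ) ⊢D G
  ⇒L⇒    : ∀ {Γ C D B G} → ((D ⇒ B) ∷ C ∷ Γ) ⊢D D → (B ∷ Γ) ⊢D G
           → (((C ⇒ D) ⇒ B) ∷ Γ) ⊢D G
  ⇒L∀    : ∀ {Γ C B G} → shiftCtx (((∀' C) ⇒ B) ∷ Γ) ⊢D C → (B ∷ Γ) ⊢D G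
           → (((∀' C) ⇒ B) ∷ Γ) ⊢D G
  ⇒L∃    : ∀ {Γ C B G} (t : Term) → (((∃' C) ⇒ B) ∷ Γ) ⊢D (C [ t ]) → (B ∷ Γ) ⊢D G
           → (((∃' C) ⇒ B) ∷ Γ) ⊢D G

module Submission where

-- Instead of translating derivations rule by rule (which would need cut
-- admissibility in K), both calculi are compared with one Kripke semantics and
-- shown sound and complete for it (normalisation by evaluation):
--
--  * Both calculi share a block of common rules; K adds Kleene's contracting
--    rule ⇒L, D adds Dyckhoff's eight implication-left rules.  These rule
--    schemas are stated for an arbitrary relation, and each calculus is the
--    least relation closed under its rules (recursion principles K-rec, D-rec).
--  * The semantics: worlds are contexts, ordered by "every hypothesis of the
--    smaller world is available in the larger one after a renaming"; the
--    disjunctive connectives, atoms and ⊥ are interpreted through a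
--    continuation monad whose answers are derivations in a chosen calculus.
--  * Soundness: the semantic consequence relation ⊨ satisfies the common,
--    Kleene and Dyckhoff rules, so every K- and every D-derivation is valid.
--  * Completeness: for any calculus with the common rules and either Kleene's
--    or Dyckhoff's implication rules, reify/reflect turn validity into
--    derivability.
--  * The theorem: a D-derivation is valid in the model answering in K, hence
--    yields a K-derivation, and symmetrically.

open import Defs
  using ( Term; var; fun; Prop; atom; ⊤; ⊥; _∧_; _∨_; _⇒_; ∀'; ∃'
        ; substT; substTs; shiftT; exts; subst; shift; _[_]; Ctx; shiftCtx; _⊢K_; _⊢D_ )
open import Data.Product using (_×_; _,_; proj₁; proj₂; Σ)
open import Data.Nat using (ℕ; zero; suc; _+_)
open import Data.Nat.Properties using (+-assoc)
open import Data.List using (List; []; _∷_; map; _++_)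
open import Data.List.Relation.Unary.All using (All; []; _∷_; tabulate)
open import Data.List.Relation.Unary.Any using (here; there)
open import Data.List.Membership.Propositional using (_∈_)
open import Data.List.Membership.Propositional.Properties using (∈-map⁺; ∈-∃++)
open import Data.List.Relation.Binary.Permutation.Propositional
  using (_↭_; ↭-sym; prep; swap) renaming (refl to ↭-refl; trans to ↭-trans)
open import Data.List.Relation.Binary.Permutation.Propositional.Properties
  using (∈-resp-↭; All-resp-↭) renaming (shift to ↭-shift)
open import Data.Sum using (_⊎_; inj₁; inj₂)
open import Data.Unit using () renaming (⊤ to Unit; tt to tt)
open import Relation.Binary.PropositionalEquality
  using (_≡_; refl; sym; trans; cong; cong₂) renaming (subst to tr)

record CommonRules (_⊢_ : Ctx → Prop → Set) : Set where
  field
    perm : ∀ {Γ Δ G} → Γ ↭ Δ → Γ ⊢ G → Δ ⊢ G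
    ax   : ∀ {Γ p ts} → (atom p ts ∷ Γ) ⊢ atom p ts
    ⊤R   : ∀ {Γ} → Γ ⊢ ⊤
    ⊥L   : ∀ {Γ G} → (⊥ ∷ Γ) ⊢ G
    ∧L   : ∀ {Γ A B G} → (A ∷ B ∷ Γ) ⊢ G → ((A ∧ B) ∷ Γ) ⊢ G
    ∧R   : ∀ {Γ A B} → Γ ⊢ A → Γ ⊢ B → Γ ⊢ (A ∧ B)
    ∨L   : ∀ {Γ A B G} → (A ∷ Γ) ⊢ G → (B ∷ Γ) ⊢ G → ((A ∨ B) ∷ Γ) ⊢ G
    ∨R₁  : ∀ {Γ A B} → Γ ⊢ A → Γ ⊢ (A ∨ B)
    ∨R₂  : ∀ {Γ A B} → Γ ⊢ B → Γ ⊢ (A ∨ B)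
    ⇒R   : ∀ {Γ A B} → (A ∷ Γ) ⊢ B → Γ ⊢ (A ⇒ B)
    ∀R   : ∀ {Γ A} → shiftCtx Γ ⊢ A → Γ ⊢ ∀' A
    ∀L   : ∀ {Γ A G} (t : Term) → (A [ t ] ∷ ∀' A ∷ Γ) ⊢ G → (∀' A ∷ Γ) ⊢ G
    ∃L   : ∀ {Γ A G} → (A ∷ shiftCtx Γ) ⊢ shift G → (∃' A ∷ Γ) ⊢ G
    ∃R   : ∀ {Γ A} (t : Term) → Γ ⊢ (A [ t ]) → Γ ⊢ ∃' A

KleeneRule : (Ctx → Prop → Set) → Set
KleeneRule _⊢_ = ∀ {Γ A B G} → ((A ⇒ B) ∷ Γ) ⊢ A → (B ∷ Γ) ⊢ G → ((A ⇒ B) ∷ Γ) ⊢ G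

record DyckhoffRules (_⊢_ : Ctx → Prop → Set) : Set where
  field
    ⇒Lax : ∀ {Γ p ts B G} → (atom p ts ∷ B ∷ Γ) ⊢ G → (atom p ts ∷ (atom p ts ⇒ B) ∷ Γ) ⊢ G
    ⇒L⊤  : ∀ {Γ B G} → (B ∷ Γ) ⊢ G → ((⊤ ⇒ B) ∷ Γ) ⊢ G
    ⇒L∧  : ∀ {Γ C D B G} → ((C ⇒ B) ∷ Γ) ⊢ C → ((D ⇒ B) ∷ Γ) ⊢ D → (B ∷ Γ) ⊢ G
           → (((C ∧ D) ⇒ B) ∷ Γ) ⊢ G
    ⇒L∨₁ : ∀ {Γ C D B G} → ((C ⇒ B) ∷ (D ⇒ B) ∷ Γ) ⊢ C → (B ∷ Γ) ⊢ G
           → (((C ∨ D) ⇒ B) ∷ Γ) ⊢ G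
    ⇒L∨₂ : ∀ {Γ C D B G} → ((C ⇒ B) ∷ (D ⇒ B) ∷ Γ) ⊢ D → (B ∷ Γ) ⊢ G
           → (((C ∨ D) ⇒ B) ∷ Γ) ⊢ G
    ⇒L⇒  : ∀ {Γ C D B G} → ((D ⇒ B) ∷ C ∷ Γ) ⊢ D → (B ∷ Γ) ⊢ G
           → (((C ⇒ D) ⇒ B) ∷ Γ) ⊢ G
    ⇒L∀  : ∀ {Γ C B G} → shiftCtx (((∀' C) ⇒ B) ∷ Γ) ⊢ C → (B ∷ Γ) ⊢ G
           → (((∀' C) ⇒ B) ∷ Γ) ⊢ G
    ⇒L∃  : ∀ {Γ C B G} (t : Term) → (((∃' C) ⇒ B) ∷ Γ) ⊢ (C [ t ]) → (B ∷ Γ) ⊢ G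
           → (((∃' C) ⇒ B) ∷ Γ) ⊢ G

K-common : CommonRules _⊢K_
K-common = record
  { perm = perm ; ax = ax ; ⊤R = ⊤R ; ⊥L = ⊥L ; ∧L = ∧L ; ∧R = ∧R ; ∨L = ∨L
  ; ∨R₁ = ∨R₁ ; ∨R₂ = ∨R₂ ; ⇒R = ⇒R ; ∀R = ∀R ; ∀L = ∀L ; ∃L = ∃L ; ∃R = ∃R }
  where open _⊢K_

K-kleene : KleeneRule _⊢K_
K-kleene = _⊢K_.⇒L

D-common : CommonRules _⊢D_
D-common = record
  { perm = perm ; ax = ax ; ⊤R = ⊤R ; ⊥L = ⊥L ; ∧L = ∧L ; ∧R = ∧R ; ∨L = ∨L
  ; ∨R₁ = ∨R₁ ; ∨R₂ = ∨R₂ ; ⇒R = ⇒R ; ∀R = ∀R ; ∀L = ∀L ; ∃L = ∃L ; ∃R = ∃R }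
  where open _⊢D_

D-dyckhoff : DyckhoffRules _⊢D_
D-dyckhoff = record
  { ⇒Lax = ⇒Lax ; ⇒L⊤ = ⇒L⊤ ; ⇒L∧ = ⇒L∧ ; ⇒L∨₁ = ⇒L∨₁ ; ⇒L∨₂ = ⇒L∨₂
  ; ⇒L⇒ = ⇒L⇒ ; ⇒L∀ = ⇒L∀ ; ⇒L∃ = ⇒L∃ }
  where open _⊢D_

module _ {R : Ctx → Prop → Set} (common : CommonRules R) (kleene : KleeneRule R) where
  private module C = CommonRules common
  open _⊢K_

  K-rec : ∀ {Γ G} → Γ ⊢K G → R Γ G
  K-rec (perm p d) = C.perm p (K-rec d)
  K-rec ax = C.ax
  K-rec ⊤R = C.⊤R
  K-rec ⊥L = C.⊥L
  K-rec (∧L d) = C.∧L (K-rec d)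
  K-rec (∧R d e) = C.∧R (K-rec d) (K-rec e)
  K-rec (∨L d e) = C.∨L (K-rec d) (K-rec e)
  K-rec (∨R₁ d) = C.∨R₁ (K-rec d)
  K-rec (∨R₂ d) = C.∨R₂ (K-rec d)
  K-rec (⇒R d) = C.⇒R (K-rec d)
  K-rec (∀R d) = C.∀R (K-rec d)
  K-rec (∀L t d) = C.∀L t (K-rec d)
  K-rec (∃L d) = C.∃L (K-rec d)
  K-rec (∃R t d) = C.∃R t (K-rec d)
  K-rec (⇒L d e) = kleene (K-rec d) (K-rec e)

module _ {R : Ctx → Prop → Set} (common : CommonRules R) (dyckhoff : DyckhoffRules R) where
  private module C = CommonRules common
  private module Dy = DyckhoffRules dyckhoff
  open _⊢D_

  D-rec : ∀ {Γ G} → Γ ⊢D G → R Γ G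
  D-rec (perm p d) = C.perm p (D-rec d)
  D-rec ax = C.ax
  D-rec ⊤R = C.⊤R
  D-rec ⊥L = C.⊥L
  D-rec (∧L d) = C.∧L (D-rec d)
  D-rec (∧R d e) = C.∧R (D-rec d) (D-rec e)
  D-rec (∨L d e) = C.∨L (D-rec d) (D-rec e)
  D-rec (∨R₁ d) = C.∨R₁ (D-rec d)
  D-rec (∨R₂ d) = C.∨R₂ (D-rec d)
  D-rec (⇒R d) = C.⇒R (D-rec d)
  D-rec (∀R d) = C.∀R (D-rec d)
  D-rec (∀L t d) = C.∀L t (D-rec d)
  D-rec (∃L d) = C.∃L (D-rec d)
  D-rec (∃R t d) = C.∃R t (D-rec d)
  D-rec (⇒Lax d) = Dy.⇒Lax (D-rec d)
  D-rec (⇒L⊤ d) = Dy.⇒L⊤ (D-rec d)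
  D-rec (⇒L∧ d e f) = Dy.⇒L∧ (D-rec d) (D-rec e) (D-rec f)
  D-rec (⇒L∨₁ d e) = Dy.⇒L∨₁ (D-rec d) (D-rec e)
  D-rec (⇒L∨₂ d e) = Dy.⇒L∨₂ (D-rec d) (D-rec e)
  D-rec (⇒L⇒ d e) = Dy.⇒L⇒ (D-rec d) (D-rec e)
  D-rec (⇒L∀ d e) = Dy.⇒L∀ (D-rec d) (D-rec e)
  D-rec (⇒L∃ t d e) = Dy.⇒L∃ t (D-rec d) (D-rec e)

-- Substitutions and their algebra.  Two substitutions are identified when they
-- agree pointwise; _≗_ is a record so that both sides remain inferable.

Sub : Set
Sub = ℕ → Term

infix 4 _≗_
record _≗_ (σ τ : Sub) : Set where
  constructor ext
  field app : ∀ n → σ n ≡ τ n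
open _≗_

≗-sym : ∀ {σ τ} → σ ≗ τ → τ ≗ σ
≗-sym e = ext λ n → sym (app e n)

≗-trans : ∀ {σ τ υ} → σ ≗ τ → τ ≗ υ → σ ≗ υ
≗-trans e f = ext λ n → trans (app e n) (app f n)

_∘ₛ_ : Sub → Sub → Sub
(σ ∘ₛ τ) n = substT σ (τ n)

_∷ₛ_ : Term → Sub → Sub
(t ∷ₛ σ) zero = t
(t ∷ₛ σ) (suc n) = σ n

wk : Sub
wk n = var (suc n)

sh : ℕ → Sub
sh k n = var (k + n)

shiftBy : ℕ → Prop → Prop
shiftBy k = subst (sh k)

-- a substitution moved to a world k variables further out
ren : ℕ → Sub → Sub
ren k ρ = sh k ∘ₛ ρ

mutual
  substT-ext : ∀ {σ τ} → σ ≗ τ → ∀ t → substT σ t ≡ substT τ t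
  substT-ext e (var n) = app e n
  substT-ext e (fun f ts) = cong (fun f) (substTs-ext e ts)

  substTs-ext : ∀ {σ τ} → σ ≗ τ → ∀ ts → substTs σ ts ≡ substTs τ ts
  substTs-ext e [] = refl
  substTs-ext e (t ∷ ts) = cong₂ _∷_ (substT-ext e t) (substTs-ext e ts)

mutual
  substT-comp : ∀ σ τ t → substT σ (substT τ t) ≡ substT (σ ∘ₛ τ) t
  substT-comp σ τ (var n) = refl
  substT-comp σ τ (fun f ts) = cong (fun f) (substTs-comp σ τ ts)

  substTs-comp : ∀ σ τ ts → substTs σ (substTs τ ts) ≡ substTs (σ ∘ₛ τ) ts
  substTs-comp σ τ [] = refl
  substTs-comp σ τ (t ∷ ts) = cong₂ _∷_ (substT-comp σ τ t) (substTs-comp σ τ ts)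

mutual
  substT-id : ∀ t → substT var t ≡ t
  substT-id (var n) = refl
  substT-id (fun f ts) = cong (fun f) (substTs-id ts)

  substTs-id : ∀ ts → substTs var ts ≡ ts
  substTs-id [] = refl
  substTs-id (t ∷ ts) = cong₂ _∷_ (substT-id t) (substTs-id ts)

exts-ext : ∀ {σ τ} → σ ≗ τ → exts σ ≗ exts τ
exts-ext e = ext λ { zero → refl ; (suc n) → cong shiftT (app e n) }

subst-ext : ∀ {σ τ} → σ ≗ τ → ∀ A → subst σ A ≡ subst τ A
subst-ext e (atom p ts) = cong (atom p) (substTs-ext e ts)
subst-ext e ⊤ = refl
subst-ext e ⊥ = refl
subst-ext e (A ∧ B) = cong₂ _∧_ (subst-ext e A) (subst-ext e B)
subst-ext e (A ∨ B) = cong₂ _∨_ (subst-ext e A) (subst-ext e B)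
subst-ext e (A ⇒ B) = cong₂ _⇒_ (subst-ext e A) (subst-ext e B)
subst-ext e (∀' A) = cong ∀' (subst-ext (exts-ext e) A)
subst-ext e (∃' A) = cong ∃' (subst-ext (exts-ext e) A)

exts-comp : ∀ σ τ → (exts σ ∘ₛ exts τ) ≗ exts (σ ∘ₛ τ)
exts-comp σ τ = ext λ
  { zero → refl
  ; (suc n) → trans (substT-comp (exts σ) wk (τ n)) (sym (substT-comp wk σ (τ n))) }

subst-comp : ∀ σ τ A → subst σ (subst τ A) ≡ subst (σ ∘ₛ τ) A
subst-comp σ τ (atom p ts) = cong (atom p) (substTs-comp σ τ ts)
subst-comp σ τ ⊤ = refl
subst-comp σ τ ⊥ = refl
subst-comp σ τ (A ∧ B) = cong₂ _∧_ (subst-comp σ τ A) (subst-comp σ τ B)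
subst-comp σ τ (A ∨ B) = cong₂ _∨_ (subst-comp σ τ A) (subst-comp σ τ B)
subst-comp σ τ (A ⇒ B) = cong₂ _⇒_ (subst-comp σ τ A) (subst-comp σ τ B)
subst-comp σ τ (∀' A) = cong ∀' (trans (subst-comp (exts σ) (exts τ) A) (subst-ext (exts-comp σ τ) A))
subst-comp σ τ (∃' A) = cong ∃' (trans (subst-comp (exts σ) (exts τ) A) (subst-ext (exts-comp σ τ) A))

exts-id : exts var ≗ var
exts-id = ext λ { zero → refl ; (suc n) → refl }

subst-id : ∀ A → subst var A ≡ A
subst-id (atom p ts) = cong (atom p) (substTs-id ts)
subst-id ⊤ = refl
subst-id ⊥ = refl
subst-id (A ∧ B) = cong₂ _∧_ (subst-id A) (subst-id B)
subst-id (A ∨ B) = cong₂ _∨_ (subst-id A) (subst-id B)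
subst-id (A ⇒ B) = cong₂ _⇒_ (subst-id A) (subst-id B)
subst-id (∀' A) = cong ∀' (trans (subst-ext exts-id A) (subst-id A))
subst-id (∃' A) = cong ∃' (trans (subst-ext exts-id A) (subst-id A))

[]-def : ∀ A t → A [ t ] ≡ subst (t ∷ₛ var) A
[]-def A t = subst-ext (ext λ { zero → refl ; (suc n) → refl }) A

shiftBy-zero : ∀ A → shiftBy 0 A ≡ A
shiftBy-zero = subst-id

sh-comp : ∀ a b → (sh a ∘ₛ sh b) ≗ sh (a + b)
sh-comp a b = ext λ n → cong var (sym (+-assoc a b n))

shiftBy-comp : ∀ a b A → shiftBy a (shiftBy b A) ≡ shiftBy (a + b) A
shiftBy-comp a b A = trans (subst-comp (sh a) (sh b) A) (subst-ext (sh-comp a b) A)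

ren-ext : ∀ k {ρ σ} → ρ ≗ σ → ren k ρ ≗ ren k σ
ren-ext k e = ext λ n → cong (substT (sh k)) (app e n)

ren-comp : ∀ a b ρ → ren a (ren b ρ) ≗ ren (a + b) ρ
ren-comp a b ρ = ext λ n → trans (substT-comp (sh a) (sh b) (ρ n)) (substT-ext (sh-comp a b) (ρ n))

ren0 : ∀ ρ → ren 0 ρ ≗ ρ
ren0 ρ = ext λ n → substT-id (ρ n)

cons-ext : ∀ t {ρ σ} → ρ ≗ σ → (t ∷ₛ ρ) ≗ (t ∷ₛ σ)
cons-ext t e = ext λ { zero → refl ; (suc n) → app e n }

ren-∘ : ∀ a ρ τ → (ren a ρ ∘ₛ τ) ≗ ren a (ρ ∘ₛ τ)
ren-∘ a ρ τ = ext λ n → sym (substT-comp (sh a) ρ (τ n))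

cons-exts : ∀ t σ τ → ((t ∷ₛ σ) ∘ₛ exts τ) ≗ (t ∷ₛ (σ ∘ₛ τ))
cons-exts t σ τ = ext λ { zero → refl ; (suc n) → substT-comp (t ∷ₛ σ) wk (τ n) }

subst-ren0 : ∀ ρ A → subst (ren 0 ρ) A ≡ subst ρ A
subst-ren0 ρ A = subst-ext (ren0 ρ) A

subst-later : ∀ k ρ A → subst (ren k (ren 0 ρ)) A ≡ shiftBy k (subst ρ A)
subst-later k ρ A = trans (subst-ext (ren-ext k (ren0 ρ)) A) (sym (subst-comp (sh k) ρ A))

exts-fresh : ∀ σ C → subst (exts σ) C ≡ subst (var zero ∷ₛ ren 1 σ) C
exts-fresh σ C = subst-ext (ext λ { zero → refl ; (suc n) → refl }) C

inst-exts : ∀ σ t C → subst (t ∷ₛ var) (subst (exts σ) C) ≡ subst (t ∷ₛ σ) C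
inst-exts σ t C = trans (subst-comp (t ∷ₛ var) (exts σ) C)
  (subst-ext (≗-trans (cons-exts t var σ) (cons-ext t (ext λ n → substT-id (σ n)))) C)

inst-subst : ∀ τ t C → (subst (exts τ) C) [ t ] ≡ subst (t ∷ₛ τ) C
inst-subst τ t C = trans ([]-def _ t) (inst-exts τ t C)

inst-later : ∀ k ρ t A → subst (t ∷ₛ ren k (ren 0 ρ)) A ≡ (subst (exts (sh k)) (subst (exts ρ) A)) [ t ]
inst-later k ρ t A = sym (trans (inst-subst (sh k) t (subst (exts ρ) A))
  (trans (subst-comp (t ∷ₛ sh k) (exts ρ) A)
         (subst-ext (≗-trans (cons-exts t (sh k) ρ) (cons-ext t (ren-ext k (≗-sym (ren0 ρ))))) A)))

inst-fresh-shift : ∀ C → C ≡ subst (var zero ∷ₛ var) (subst (exts (sh 1)) C)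
inst-fresh-shift C = sym (trans (subst-comp (var zero ∷ₛ var) (exts (sh 1)) C)
  (trans (subst-ext (ext λ { zero → refl ; (suc n) → refl }) C) (subst-id C)))

-- A hypothesis H is *available* in a context Δ when it is a member of
-- Δ or follows from members of Δ by the invertible steps of D: weakening an
-- implication's conclusion, introducing ∧, ∨, ∃ on available parts, and the
-- currying/splitting of implications with compound antecedents.

extract : ∀ {x : Prop} {xs} → x ∈ xs → Σ Ctx (λ ys → xs ↭ x ∷ ys)
extract h with ys , zs , refl ← ∈-∃++ h = ys ++ zs , ↭-shift _ ys zs

data Avail (Δ : Ctx) : Prop → Set where
  mem    : ∀ {H} → H ∈ Δ → Avail Δ H
  viaB   : ∀ {A B} → Avail Δ B → Avail Δ (A ⇒ B)
  via∧   : ∀ {C D} → Avail Δ C → Avail Δ D → Avail Δ (C ∧ D)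
  via∨₁  : ∀ {C D} → Avail Δ C → Avail Δ (C ∨ D)
  via∨₂  : ∀ {C D} → Avail Δ D → Avail Δ (C ∨ D)
  via∃   : ∀ {C} t → Avail Δ (subst (t ∷ₛ var) C) → Avail Δ (∃' C)
  via⇒∧₁ : ∀ {C D B} → Avail Δ (C ⇒ B) → Avail Δ ((C ∧ D) ⇒ B)
  via⇒∧₂ : ∀ {C D B} → Avail Δ (D ⇒ B) → Avail Δ ((C ∧ D) ⇒ B)
  via⇒∨  : ∀ {C D B} → Avail Δ (C ⇒ B) → Avail Δ (D ⇒ B) → Avail Δ ((C ∨ D) ⇒ B)
  via⇒⇒  : ∀ {C D B} → Avail Δ C → Avail Δ (D ⇒ B) → Avail Δ ((C ⇒ D) ⇒ B)

_≤[_]_ : Ctx → ℕ → Ctx → Set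
Δ ≤[ k ] Δ' = ∀ {H} → H ∈ Δ → Avail Δ' (shiftBy k H)

Avail-mono : ∀ {Δ Δ' k H} → Avail Δ H → Δ ≤[ k ] Δ' → Avail Δ' (shiftBy k H)
Avail-mono (mem h) le = le h
Avail-mono (viaB a) le = viaB (Avail-mono a le)
Avail-mono (via∧ a b) le = via∧ (Avail-mono a le) (Avail-mono b le)
Avail-mono (via∨₁ a) le = via∨₁ (Avail-mono a le)
Avail-mono (via∨₂ a) le = via∨₂ (Avail-mono a le)
Avail-mono {Δ' = Δ'} {k} (via∃ {C} t a) le =
  via∃ (substT (sh k) t) (tr (Avail Δ') shift-inst (Avail-mono a le))
  where
    shift-inst : shiftBy k (subst (t ∷ₛ var) C)
                 ≡ subst (substT (sh k) t ∷ₛ var) (subst (exts (sh k)) C)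
    shift-inst = trans (subst-comp (sh k) (t ∷ₛ var) C)
      (trans (subst-ext (ext λ { zero → refl ; (suc n) → refl }) C)
             (sym (subst-comp (substT (sh k) t ∷ₛ var) (exts (sh k)) C)))
Avail-mono (via⇒∧₁ a) le = via⇒∧₁ (Avail-mono a le)
Avail-mono (via⇒∧₂ a) le = via⇒∧₂ (Avail-mono a le)
Avail-mono (via⇒∨ a b) le = via⇒∨ (Avail-mono a le) (Avail-mono b le)
Avail-mono (via⇒⇒ a b) le = via⇒⇒ (Avail-mono a le) (Avail-mono b le)

≤-refl : ∀ {Δ} → Δ ≤[ 0 ] Δ
≤-refl {Δ} {H} h = mem (tr (_∈ Δ) (sym (shiftBy-zero H)) h)

≤-trans : ∀ {Δ1 Δ2 Δ3 a b} → Δ1 ≤[ a ] Δ2 → Δ2 ≤[ b ] Δ3 → Δ1 ≤[ b + a ] Δ3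
≤-trans {Δ3 = Δ3} {a} {b} l1 l2 {H} h = tr (Avail Δ3) (shiftBy-comp b a H) (Avail-mono (l1 h) l2)

Avail-ren : ∀ {Δ Δ' k ρ} H → Avail Δ (subst ρ H) → Δ ≤[ k ] Δ' → Avail Δ' (subst (ren k ρ) H)
Avail-ren {Δ' = Δ'} {k} {ρ} H a le = tr (Avail Δ') (subst-comp (sh k) ρ H) (Avail-mono a le)

≤-step : ∀ {Δ Δ0 Δ'} → Δ ↭ Δ0 → (∀ {H} → H ∈ Δ0 → Avail Δ' H) → Δ ≤[ 0 ] Δ'
≤-step {Δ' = Δ'} p f {H} h = tr (Avail Δ') (sym (shiftBy-zero H)) (f (∈-resp-↭ p h))

≤-fresh : ∀ {Δ Δ0} → Δ ↭ Δ0 → Δ ≤[ 1 ] map shift Δ0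
≤-fresh p h = mem (∈-map⁺ shift (∈-resp-↭ p h))

≤-replace : ∀ {Δ A B Γ} → Δ ↭ A ∷ Γ → Avail (B ∷ Γ) A → Δ ≤[ 0 ] (B ∷ Γ)
≤-replace q a = ≤-step q (λ { (here refl) → a ; (there h) → mem (there h) })

≤-replace₂ : ∀ {Δ A B₁ B₂ Γ} → Δ ↭ A ∷ Γ → Avail (B₁ ∷ B₂ ∷ Γ) A → Δ ≤[ 0 ] (B₁ ∷ B₂ ∷ Γ)
≤-replace₂ q a = ≤-step q (λ { (here refl) → a ; (there h) → mem (there (there h)) })

≤-extend : ∀ {Δ A} → Δ ≤[ 0 ] (A ∷ Δ)
≤-extend = ≤-step ↭-refl (λ h → mem (there h))

≤-split∨ : ∀ {Δ C D B Γ} → Δ ↭ ((C ∨ D) ⇒ B) ∷ Γ → Δ ≤[ 0 ] ((C ⇒ B) ∷ (D ⇒ B) ∷ Γ)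
≤-split∨ q = ≤-replace₂ q (via⇒∨ (mem (here refl)) (mem (there (here refl))))

-- The parameter _⊢_ is the calculus in
-- which the continuations answer; a formula A is interpreted, under a valuation
-- ρ of its free variables, as a predicate ⟦ A ⟧ ρ on worlds.  Atoms, ⊥, ∨ and ∃
-- are forced through the modality M: "in every extension, for every goal, any
-- continuation handling S in further extensions yields a derivation of the goal".
module Semantics (_⊢_ : Ctx → Prop → Set) where

  record M (S : Sub → Ctx → Set) (ρ : Sub) (Δ : Ctx) : Set where
    constructor mk
    field runM : ∀ {k Δ1} → Δ ≤[ k ] Δ1 → (G : Prop) →
                 (∀ {k' Δ2} → Δ1 ≤[ k' ] Δ2 → S (ren k' (ren k ρ)) Δ2 → Δ2 ⊢ shiftBy k' G) → Δ1 ⊢ G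
  open M public

  Stable : (Sub → Ctx → Set) → Set
  Stable S = ∀ {ρ σ Δ} → ρ ≗ σ → S ρ Δ → S σ Δ

  M-map : ∀ {S S' : Sub → Ctx → Set} {ρ ρ' Δ} →
          (∀ {a b Δ'} → S (ren a (ren b ρ)) Δ' → S' (ren a (ren b ρ')) Δ') → M S ρ Δ → M S' ρ' Δ
  M-map f m = mk λ le G c → runM m le G (λ le' s → c le' (f s))

  M-cast : ∀ {S} → Stable S → Stable (M S)
  M-cast {S} st e m = M-map {S} {S} (λ {a} {b} s → st (ren-ext a (ren-ext b e)) s) m

  M-mono : ∀ {S} → Stable S → ∀ {ρ Δ Δ' j} → M S ρ Δ → Δ ≤[ j ] Δ' → M S (ren j ρ) Δ'
  M-mono st {ρ} {j = j} m le = mk λ {k} le1 G c →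
    runM m (≤-trans le le1) G (λ {k'} le2 s → c le2 (st (ren-ext k' (≗-sym (ren-comp k j ρ))) s))

  M-ret : ∀ {S} → Stable S → ∀ {ρ Δ} → (∀ {k Δ'} → Δ ≤[ k ] Δ' → S (ren k ρ) Δ') → M S ρ Δ
  M-ret st {ρ} s = mk λ {k} {Δ1} le G c →
    tr (Δ1 ⊢_) (shiftBy-zero G) (c ≤-refl (st (≗-sym (ren0 (ren k ρ))) (s le)))

  M-join : ∀ {S} → Stable S → ∀ {ρ Δ} → M (M S) ρ Δ → M S ρ Δ
  M-join st {ρ} m = mk λ {k} {Δ1} le G c →
    runM m le G (λ {k'} {Δ2} le' inner →
      runM inner ≤-refl (shiftBy k' G) (λ {k''} {Δ3} le'' s →
        tr (Δ3 ⊢_) (sym (shiftBy-comp k'' k' G))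
          (c (≤-trans le' le'')
             (st (≗-trans (ren-ext k'' (ren0 (ren k' (ren k ρ)))) (ren-comp k'' k' (ren k ρ))) s))))

  Atom : ℕ → List Term → Sub → Ctx → Set
  Atom p ts σ Δ' = Avail Δ' (atom p (substTs σ ts))

  -- uninhabited; a datatype rather than the empty type so that its indices stay inferable
  data Absurd (σ : Sub) (Δ : Ctx) : Set where

  ⟦_⟧ : Prop → Sub → Ctx → Set
  Either : Prop → Prop → Sub → Ctx → Set
  Witnessed : Prop → Sub → Ctx → Set

  ⟦ atom p ts ⟧ ρ Δ = M (Atom p ts) ρ Δ
  ⟦ ⊤ ⟧ ρ Δ = Unit
  ⟦ ⊥ ⟧ ρ Δ = M Absurd ρ Δ
  ⟦ A ∧ B ⟧ ρ Δ = ⟦ A ⟧ ρ Δ × ⟦ B ⟧ ρ Δ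
  ⟦ A ∨ B ⟧ ρ Δ = M (Either A B) ρ Δ
  ⟦ A ⇒ B ⟧ ρ Δ = ∀ {k Δ'} → Δ ≤[ k ] Δ' → ⟦ A ⟧ (ren k ρ) Δ' → ⟦ B ⟧ (ren k ρ) Δ'
  ⟦ ∀' A ⟧ ρ Δ = ∀ {k Δ'} → Δ ≤[ k ] Δ' → (t : Term) → ⟦ A ⟧ (t ∷ₛ ren k ρ) Δ'
  ⟦ ∃' A ⟧ ρ Δ = M (Witnessed A) ρ Δ

  Either A B σ Δ' = ⟦ A ⟧ σ Δ' ⊎ ⟦ B ⟧ σ Δ'
  Witnessed A σ Δ' = Σ Term (λ t → ⟦ A ⟧ (t ∷ₛ σ) Δ')

  Atom-stable : ∀ p ts → Stable (Atom p ts)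
  Atom-stable p ts {Δ = Δ} e a = tr (λ us → Avail Δ (atom p us)) (substTs-ext e ts) a

  Absurd-stable : Stable Absurd
  Absurd-stable e ()

  mutual
    cast : ∀ A → Stable ⟦ A ⟧
    cast (atom p ts) e v = M-cast (Atom-stable p ts) e v
    cast ⊤ e v = tt
    cast ⊥ e v = M-cast Absurd-stable e v
    cast (A ∧ B) e (a , b) = cast A e a , cast B e b
    cast (A ∨ B) e v = M-cast (Either-stable A B) e v
    cast (A ⇒ B) e f {k} le a = cast B (ren-ext k e) (f le (cast A (≗-sym (ren-ext k e)) a))
    cast (∀' A) e f {k} le t = cast A (cons-ext t (ren-ext k e)) (f le t)
    cast (∃' A) e v = M-cast (Witnessed-stable A) e v

    Either-stable : ∀ A B → Stable (Either A B)
    Either-stable A B e (inj₁ a) = inj₁ (cast A e a)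
    Either-stable A B e (inj₂ b) = inj₂ (cast B e b)

    Witnessed-stable : ∀ A → Stable (Witnessed A)
    Witnessed-stable A e (t , a) = t , cast A (cons-ext t e) a

  mono : ∀ A {ρ Δ Δ' j} → ⟦ A ⟧ ρ Δ → Δ ≤[ j ] Δ' → ⟦ A ⟧ (ren j ρ) Δ'
  mono (atom p ts) v le = M-mono (Atom-stable p ts) v le
  mono ⊤ v le = tt
  mono ⊥ v le = M-mono Absurd-stable v le
  mono (A ∧ B) (a , b) le = mono A a le , mono B b le
  mono (A ∨ B) v le = M-mono (Either-stable A B) v le
  mono (A ⇒ B) {ρ} {j = j} f le {k} le1 a =
    cast B (≗-sym (ren-comp k j ρ)) (f (≤-trans le le1) (cast A (ren-comp k j ρ) a))
  mono (∀' A) {ρ} {j = j} f le {k} le1 t =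
    cast A (cons-ext t (≗-sym (ren-comp k j ρ))) (f (≤-trans le le1) t)
  mono (∃' A) v le = M-mono (Witnessed-stable A) v le

  -- every interpretation is closed under M (it is a "sheaf"), so M can be escaped
  run : ∀ A {ρ Δ} → M ⟦ A ⟧ ρ Δ → ⟦ A ⟧ ρ Δ
  run (atom p ts) m = M-join (Atom-stable p ts) m
  run ⊤ m = tt
  run ⊥ m = M-join Absurd-stable m
  run (A ∧ B) {ρ} m = run A (M-map {⟦ A ∧ B ⟧} {⟦ A ⟧} {ρ} {ρ} proj₁ m)
                    , run B (M-map {⟦ A ∧ B ⟧} {⟦ B ⟧} {ρ} {ρ} proj₂ m)
  run (A ∨ B) m = M-join (Either-stable A B) m
  run (A ⇒ B) {ρ} m {k} le a = run B (mk λ {k1} le1 G c →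
    runM m (≤-trans le le1) G (λ {k2} le2 f →
      c le2 (cast B (≗-trans (ren0 _) (same k1 k2))
        (f ≤-refl (cast A (≗-trans (≗-sym (ren-comp k2 k1 (ren k ρ)))
                          (≗-trans (≗-sym (same k1 k2)) (≗-sym (ren0 _))))
                    (mono A a (≤-trans le1 le2)))))))
    where
      same : ∀ k1 k2 → ren k2 (ren (k1 + k) ρ) ≗ ren k2 (ren k1 (ren k ρ))
      same k1 k2 = ren-ext k2 (≗-sym (ren-comp k1 k ρ))
  run (∀' A) {ρ} m {k} le t = run A (mk λ {k1} le1 G c →
    runM m (≤-trans le le1) G (λ {k2} le2 f →
      c le2 (cast A (ext λ { zero → refl
                           ; (suc n) → trans (app (ren0 (ren k2 (ren (k1 + k) ρ))) n)
                                             (app (ren-ext k2 (≗-sym (ren-comp k1 k ρ))) n) })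
        (f ≤-refl (substT (sh k2) (substT (sh k1) t))))))
  run (∃' A) m = M-join (Witnessed-stable A) m

  ren-∘-twice : ∀ a b ρ τ → (ren a (ren b ρ) ∘ₛ τ) ≗ ren a (ren b (ρ ∘ₛ τ))
  ren-∘-twice a b ρ τ = ≗-trans (ren-∘ a (ren b ρ) τ) (ren-ext a (ren-∘ b ρ τ))

  mutual
    sub→ : ∀ A τ {ρ Δ} → ⟦ subst τ A ⟧ ρ Δ → ⟦ A ⟧ (ρ ∘ₛ τ) Δ
    sub→ (atom p ts) τ {ρ} v = M-map (λ {a} {b} {Δ'} x → tr (λ us → Avail Δ' (atom p us))
      (trans (substTs-comp _ τ ts) (substTs-ext (ren-∘-twice a b ρ τ) ts)) x) v
    sub→ ⊤ τ v = tt
    sub→ ⊥ τ v = M-map (λ ()) v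
    sub→ (A ∧ B) τ (a , b) = sub→ A τ a , sub→ B τ b
    sub→ (A ∨ B) τ {ρ} v = M-map
      (λ { {a} {b} (inj₁ x) → inj₁ (cast A (ren-∘-twice a b ρ τ) (sub→ A τ x))
         ; {a} {b} (inj₂ x) → inj₂ (cast B (ren-∘-twice a b ρ τ) (sub→ B τ x)) }) v
    sub→ (A ⇒ B) τ {ρ} f {k} le a =
      cast B (ren-∘ k ρ τ) (sub→ B τ (f le (sub← A τ (cast A (≗-sym (ren-∘ k ρ τ)) a))))
    sub→ (∀' A) τ {ρ} f {k} le t =
      cast A (≗-trans (cons-exts t (ren k ρ) τ) (cons-ext t (ren-∘ k ρ τ))) (sub→ A (exts τ) (f le t))
    sub→ (∃' A) τ {ρ} v = M-map
      (λ { {a} {b} (t , x) → t , cast A (≗-trans (cons-exts t _ τ) (cons-ext t (ren-∘-twice a b ρ τ)))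
                                        (sub→ A (exts τ) x) }) v

    sub← : ∀ A τ {ρ Δ} → ⟦ A ⟧ (ρ ∘ₛ τ) Δ → ⟦ subst τ A ⟧ ρ Δ
    sub← (atom p ts) τ {ρ} v = M-map (λ {a} {b} {Δ'} x → tr (λ us → Avail Δ' (atom p us))
      (sym (trans (substTs-comp _ τ ts) (substTs-ext (ren-∘-twice a b ρ τ) ts))) x) v
    sub← ⊤ τ v = tt
    sub← ⊥ τ v = M-map (λ ()) v
    sub← (A ∧ B) τ (a , b) = sub← A τ a , sub← B τ b
    sub← (A ∨ B) τ {ρ} v = M-map
      (λ { {a} {b} (inj₁ x) → inj₁ (sub← A τ (cast A (≗-sym (ren-∘-twice a b ρ τ)) x))
         ; {a} {b} (inj₂ x) → inj₂ (sub← B τ (cast B (≗-sym (ren-∘-twice a b ρ τ)) x)) }) v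
    sub← (A ⇒ B) τ {ρ} f {k} le a =
      sub← B τ (cast B (≗-sym (ren-∘ k ρ τ)) (f le (cast A (ren-∘ k ρ τ) (sub→ A τ a))))
    sub← (∀' A) τ {ρ} f {k} le t =
      sub← A (exts τ) (cast A (≗-sym (≗-trans (cons-exts t (ren k ρ) τ) (cons-ext t (ren-∘ k ρ τ)))) (f le t))
    sub← (∃' A) τ {ρ} v = M-map
      (λ { {a} {b} (t , x) → t , sub← A (exts τ)
             (cast A (≗-sym (≗-trans (cons-exts t _ τ) (cons-ext t (ren-∘-twice a b ρ τ)))) x) }) v

  M-bind : ∀ {S} → Stable S → ∀ G {ρ Δ} → M S ρ Δ →
           (∀ {k Δ'} → Δ ≤[ k ] Δ' → S (ren k ρ) Δ' → ⟦ G ⟧ (ren k ρ) Δ') → ⟦ G ⟧ ρ Δ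
  M-bind st G {ρ} m f = run G (mk λ {k} le G' c → runM m le G' (λ {k'} le' s →
     c le' (cast G (≗-sym (ren-comp k' k ρ)) (f (≤-trans le le') (st (ren-comp k' k ρ) s)))))

  ∃-intro : ∀ A {ρ Δ} t → ⟦ A ⟧ (t ∷ₛ ρ) Δ → ⟦ ∃' A ⟧ ρ Δ
  ∃-intro A {ρ} t v = M-ret (Witnessed-stable A) (λ {k} le → substT (sh k) t ,
    cast A (ext λ { zero → refl ; (suc n) → refl }) (mono A v le))

  ∨-intro₁ : ∀ A B {ρ Δ} → ⟦ A ⟧ ρ Δ → ⟦ A ∨ B ⟧ ρ Δ
  ∨-intro₁ A B a = M-ret (Either-stable A B) (λ le → inj₁ (mono A a le))

  ∨-intro₂ : ∀ A B {ρ Δ} → ⟦ B ⟧ ρ Δ → ⟦ A ∨ B ⟧ ρ Δ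
  ∨-intro₂ A B b = M-ret (Either-stable A B) (λ le → inj₂ (mono B b le))

  ∨-from-Either : ∀ A B {ρ Δ} → Either A B ρ Δ → ⟦ A ∨ B ⟧ ρ Δ
  ∨-from-Either A B (inj₁ a) = ∨-intro₁ A B a
  ∨-from-Either A B (inj₂ b) = ∨-intro₂ A B b

  ⇒-elim : ∀ A B {ρ Δ} → ⟦ A ⇒ B ⟧ ρ Δ → ⟦ A ⟧ ρ Δ → ⟦ B ⟧ ρ Δ
  ⇒-elim A B {ρ} f a = cast B (ren0 ρ) (f ≤-refl (cast A (≗-sym (ren0 ρ)) a))

  ∀-elim : ∀ A {ρ Δ} t → ⟦ ∀' A ⟧ ρ Δ → ⟦ A [ t ] ⟧ ρ Δ
  ∀-elim A {ρ} {Δ} t g = tr (λ X → ⟦ X ⟧ ρ Δ) (sym ([]-def A t))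
    (sub← A (t ∷ₛ var) (cast A (ext λ { zero → refl ; (suc n) → app (ren0 ρ) n }) (g ≤-refl (substT ρ t))))

  ∃-intro[] : ∀ A {ρ Δ} t → ⟦ A [ t ] ⟧ ρ Δ → ⟦ ∃' A ⟧ ρ Δ
  ∃-intro[] A {ρ} {Δ} t v = ∃-intro A (substT ρ t) (cast A (ext λ { zero → refl ; (suc n) → refl })
    (sub→ A (t ∷ₛ var) (tr (λ X → ⟦ X ⟧ ρ Δ) ([]-def A t) v)))

  Env : Ctx → Sub → Ctx → Set
  Env Γ ρ Δ = All (λ H → ⟦ H ⟧ ρ Δ) Γ

  Env-mono : ∀ {Γ ρ Δ Δ' j} → Env Γ ρ Δ → Δ ≤[ j ] Δ' → Env Γ (ren j ρ) Δ'
  Env-mono {[]} [] le = []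
  Env-mono {H ∷ Γ} (v ∷ vs) le = mono H v le ∷ Env-mono vs le

  Env-shift : ∀ {Γ σ Δ} t → Env Γ σ Δ → Env (shiftCtx Γ) (t ∷ₛ σ) Δ
  Env-shift {[]} t [] = []
  Env-shift {H ∷ Γ} t (v ∷ vs) = sub← H wk v ∷ Env-shift t vs

  _⊨_ : Ctx → Prop → Set
  Γ ⊨ G = ∀ {ρ Δ} → Env Γ ρ Δ → ⟦ G ⟧ ρ Δ

module Soundness (_⊢_ : Ctx → Prop → Set) where
  open Semantics _⊢_

  ⊨-common : CommonRules _⊨_
  ⊨-common = record
    { perm = λ p d env → d (All-resp-↭ (↭-sym p) env)
    ; ax = λ { (v ∷ env) → v }
    ; ⊤R = λ env → tt
    ; ⊥L = ⊨-⊥L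
    ; ∧L = λ { d ((a , b) ∷ env) → d (a ∷ b ∷ env) }
    ; ∧R = λ d e env → d env , e env
    ; ∨L = ⊨-∨L
    ; ∨R₁ = λ { {A = A} {B} d env → ∨-intro₁ A B (d env) }
    ; ∨R₂ = λ { {A = A} {B} d env → ∨-intro₂ A B (d env) }
    ; ⇒R = λ d env le a → d (a ∷ Env-mono env le)
    ; ∀R = λ d env le t → d (Env-shift t (Env-mono env le))
    ; ∀L = λ { {A = A} t d (g ∷ env) → d (∀-elim A t g ∷ g ∷ env) }
    ; ∃L = ⊨-∃L
    ; ∃R = λ { {A = A} t d env → ∃-intro[] A t (d env) }
    }
    where
      ⊨-⊥L : ∀ {Γ G} → (⊥ ∷ Γ) ⊨ G
      ⊨-⊥L {G = G} (v ∷ env) = M-bind Absurd-stable G v (λ _ ())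

      ⊨-∨L : ∀ {Γ A B G} → (A ∷ Γ) ⊨ G → (B ∷ Γ) ⊨ G → ((A ∨ B) ∷ Γ) ⊨ G
      ⊨-∨L {A = A} {B} {G} d e (v ∷ env) = M-bind (Either-stable A B) G v λ
        { le (inj₁ a) → d (a ∷ Env-mono env le)
        ; le (inj₂ b) → e (b ∷ Env-mono env le) }

      -- the eigenvariable is valued by the witness, and the goal is shifted back
      ⊨-∃L : ∀ {Γ A G} → (A ∷ shiftCtx Γ) ⊨ shift G → (∃' A ∷ Γ) ⊨ G
      ⊨-∃L {A = A} {G} d (v ∷ env) = M-bind (Witnessed-stable A) G v
        (λ le (t , a) → sub→ G wk (d (a ∷ Env-shift t (Env-mono env le))))

  ⊨-kleene : KleeneRule _⊨_
  ⊨-kleene {A = A} {B} d e (f ∷ env) = e (⇒-elim A B f (d (f ∷ env)) ∷ env)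

  -- Each Dyckhoff rule is valid because its premises' new hypotheses
  -- (C ⇒ B, D ⇒ B, ...) follow semantically from the principal formula.
  ⊨-⇒L∧ : ∀ {Γ C D B G} → ((C ⇒ B) ∷ Γ) ⊨ C → ((D ⇒ B) ∷ Γ) ⊨ D → (B ∷ Γ) ⊨ G
          → (((C ∧ D) ⇒ B) ∷ Γ) ⊨ G
  ⊨-⇒L∧ {C = C} {D} {B} dC dD dG {ρ} {Δ} (f ∷ env) = dG (⇒-elim C B f-curried c ∷ env)
    where
      f-curried-D : ∀ {k Δ'} → Δ ≤[ k ] Δ' → ⟦ C ⟧ (ren k ρ) Δ' → ⟦ D ⇒ B ⟧ (ren k ρ) Δ'
      f-curried-D {k} le c {k'} le' d = cast B (≗-sym (ren-comp k' k ρ))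
        (f (≤-trans le le') (cast C (ren-comp k' k ρ) (mono C c le') , cast D (ren-comp k' k ρ) d))
      f-curried : ⟦ C ⇒ B ⟧ ρ Δ
      f-curried le c = f le (c , dD (f-curried-D le c ∷ Env-mono env le))
      c : ⟦ C ⟧ ρ Δ
      c = dC (f-curried ∷ env)

  ⇒-split∨ : ∀ C D B {ρ Δ} → ⟦ (C ∨ D) ⇒ B ⟧ ρ Δ → ⟦ C ⇒ B ⟧ ρ Δ × ⟦ D ⇒ B ⟧ ρ Δ
  ⇒-split∨ C D B {ρ} f = (λ {k} le c → f le (∨-intro₁ C D {ren k ρ} c))
                       , (λ {k} le d → f le (∨-intro₂ C D {ren k ρ} d))

  ⊨-⇒L∨₁ : ∀ {Γ C D B G} → ((C ⇒ B) ∷ (D ⇒ B) ∷ Γ) ⊨ C → (B ∷ Γ) ⊨ G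
           → (((C ∨ D) ⇒ B) ∷ Γ) ⊨ G
  ⊨-⇒L∨₁ {C = C} {D} {B} dC dG {ρ} (f ∷ env) =
    let (gC , gD) = ⇒-split∨ C D B {ρ} f in dG (⇒-elim C B gC (dC (gC ∷ gD ∷ env)) ∷ env)

  ⊨-⇒L∨₂ : ∀ {Γ C D B G} → ((C ⇒ B) ∷ (D ⇒ B) ∷ Γ) ⊨ D → (B ∷ Γ) ⊨ G
           → (((C ∨ D) ⇒ B) ∷ Γ) ⊨ G
  ⊨-⇒L∨₂ {C = C} {D} {B} dD dG {ρ} (f ∷ env) =
    let (gC , gD) = ⇒-split∨ C D B {ρ} f in dG (⇒-elim D B gD (dD (gC ∷ gD ∷ env)) ∷ env)

  ⊨-⇒L⇒ : ∀ {Γ C D B G} → ((D ⇒ B) ∷ C ∷ Γ) ⊨ D → (B ∷ Γ) ⊨ G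
          → (((C ⇒ D) ⇒ B) ∷ Γ) ⊨ G
  ⊨-⇒L⇒ {C = C} {D} {B} dD dG {ρ} {Δ} (f ∷ env) = dG (⇒-elim (C ⇒ D) B f c⇒d ∷ env)
    where
      -- (C ⇒ D) ⇒ B yields D ⇒ B, as D entails C ⇒ D
      d⇒b : ∀ {k Δ'} → Δ ≤[ k ] Δ' → ⟦ D ⇒ B ⟧ (ren k ρ) Δ'
      d⇒b {k} le {k'} le' d = cast B (≗-sym (ren-comp k' k ρ))
        (f (≤-trans le le') (λ {k''} le'' _ → cast D (ren-ext k'' (ren-comp k' k ρ)) (mono D d le'')))
      c⇒d : ⟦ C ⇒ D ⟧ ρ Δ
      c⇒d le c = dD (d⇒b le ∷ c ∷ Env-mono env le)

  ⊨-⇒L∀ : ∀ {Γ C B G} → shiftCtx (((∀' C) ⇒ B) ∷ Γ) ⊨ C → (B ∷ Γ) ⊨ G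
          → (((∀' C) ⇒ B) ∷ Γ) ⊨ G
  ⊨-⇒L∀ {Γ} {C} {B} dC dG (f ∷ env) =
    dG (⇒-elim (∀' C) B f (λ le t → dC (Env-shift t (Env-mono {((∀' C) ⇒ B) ∷ Γ} (f ∷ env) le))) ∷ env)

  ⊨-dyckhoff : DyckhoffRules _⊨_
  ⊨-dyckhoff = record
    { ⇒Lax = λ { {p = p} {ts} {B} d (a ∷ f ∷ env) → d (a ∷ ⇒-elim (atom p ts) B f a ∷ env) }
    ; ⇒L⊤ = λ { {B = B} d (f ∷ env) → d (⇒-elim ⊤ B f tt ∷ env) }
    ; ⇒L∧ = ⊨-⇒L∧
    ; ⇒L∨₁ = ⊨-⇒L∨₁
    ; ⇒L∨₂ = ⊨-⇒L∨₂
    ; ⇒L⇒ = ⊨-⇒L⇒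
    ; ⇒L∀ = ⊨-⇒L∀
    ; ⇒L∃ = λ { {C = C} {B} t dC dG (f ∷ env) →
                dG (⇒-elim (∃' C) B f (∃-intro[] C t (dC (f ∷ env))) ∷ env) }
    }

  K-sound : ∀ {Γ G} → Γ ⊢K G → Γ ⊨ G
  K-sound = K-rec ⊨-common ⊨-kleene

  D-sound : ∀ {Γ G} → Γ ⊢D G → Γ ⊨ G
  D-sound = D-rec ⊨-common ⊨-dyckhoff

data ImplicationLeft (_⊢_ : Ctx → Prop → Set) : Set where
  kleene   : KleeneRule _⊢_ → ImplicationLeft _⊢_
  dyckhoff : DyckhoffRules _⊢_ → ImplicationLeft _⊢_

-- Completeness: in the model answering in a calculus with the common rules and
-- either kind of implication-left rules, every semantic consequence is
-- derivable.  reify reads a derivation off a semantic value; reflect turns an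
-- available hypothesis into a semantic value, applying left rules lazily
-- inside continuations.  Dyckhoff's rules are applicable because an
-- implication is only decomposed once its antecedent's shape is known.
module Completeness (_⊢_ : Ctx → Prop → Set) (common : CommonRules _⊢_)
                    (implicationLeft : ImplicationLeft _⊢_) where
  open Semantics _⊢_
  open CommonRules common
  open DyckhoffRules

  coe⊢ : ∀ {Δ A B} → A ≡ B → Δ ⊢ A → Δ ⊢ B
  coe⊢ refl d = d

  unperm : ∀ {Δ Δ0 G} → Δ ↭ Δ0 → Δ0 ⊢ G → Δ ⊢ G
  unperm q d = perm (↭-sym q) d

  Kont : Prop → Sub → Ctx → Prop → Set
  Kont Y σ Δ G = ∀ {k Δ'} → Δ ≤[ k ] Δ' → ⟦ Y ⟧ (ren k σ) Δ' → Δ' ⊢ shiftBy k G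

  Kont-mono : ∀ {Y σ Δ Δ' G j} → Kont Y σ Δ G → Δ ≤[ j ] Δ' → Kont Y (ren j σ) Δ' (shiftBy j G)
  Kont-mono {Y} {σ} {G = G} {j} c le {k} le' y =
    coe⊢ (sym (shiftBy-comp k j G)) (c (≤-trans le le') (cast Y (ren-comp k j σ) y))

  resume-with : ∀ {S} → Stable S → ∀ {σ Δ Δ' G} →
                (∀ {k Δ2} → Δ ≤[ k ] Δ2 → S (ren k σ) Δ2 → Δ2 ⊢ shiftBy k G) →
                Δ ≤[ 0 ] Δ' → S σ Δ' → Δ' ⊢ G
  resume-with st {σ} {G = G} c le s = coe⊢ (shiftBy-zero G) (c le (st (≗-sym (ren0 σ)) s))

  resume : ∀ {Y σ Δ Δ' G} → Kont Y σ Δ G → Δ ≤[ 0 ] Δ' → ⟦ Y ⟧ σ Δ' → Δ' ⊢ G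
  resume {Y} c le y = resume-with (cast Y) c le y

  -- atoms and ⊥ are only available as members, so the axioms apply
  ax-avail : ∀ {Δ p us} → Avail Δ (atom p us) → Δ ⊢ atom p us
  ax-avail (mem h) = unperm (proj₂ (extract h)) ax

  ⊥-avail : ∀ {Δ G} → Avail Δ ⊥ → Δ ⊢ G
  ⊥-avail (mem h) = unperm (proj₂ (extract h)) ⊥L

  mutual
    reify : ∀ A {ρ Δ} → ⟦ A ⟧ ρ Δ → Δ ⊢ subst ρ A
    reify (atom p ts) {ρ} v =
      runM v ≤-refl (subst ρ (atom p ts)) (λ {k} le a → coe⊢ (subst-later k ρ (atom p ts)) (ax-avail a))
    reify ⊤ v = ⊤R
    reify ⊥ v = runM v ≤-refl ⊥ (λ _ ())
    reify (A ∧ B) (a , b) = ∧R (reify A a) (reify B b)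
    reify (A ∨ B) {ρ} v = runM v ≤-refl (subst ρ (A ∨ B)) λ
      { {k} le (inj₁ a) → ∨R₁ (coe⊢ (subst-later k ρ A) (reify A a))
      ; {k} le (inj₂ b) → ∨R₂ (coe⊢ (subst-later k ρ B) (reify B b)) }
    reify (A ⇒ B) {ρ} f =
      ⇒R (coe⊢ (subst-ren0 ρ B) (reify B (f ≤-extend (reflect A (mem (here (subst-ren0 ρ A)))))))
    reify (∀' A) {ρ} f = ∀R (coe⊢ (sym (exts-fresh ρ A)) (reify A (f (≤-fresh ↭-refl) (var zero))))
    reify (∃' A) {ρ} v = runM v ≤-refl (subst ρ (∃' A))
      (λ {k} le (t , a) → ∃R t (coe⊢ (inst-later k ρ t A) (reify A a)))

    reflect : ∀ H {ρ Δ} → Avail Δ (subst ρ H) → ⟦ H ⟧ ρ Δ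
    reflect (atom p ts) av = M-ret (Atom-stable p ts) (λ le → Avail-ren (atom p ts) av le)
    reflect ⊤ av = tt
    reflect ⊥ {ρ} av = mk λ le G c → ⊥-avail (Avail-ren {ρ = ρ} ⊥ av le)
    reflect (C ∧ D) av =
      run C (mk λ le G c → use∧ C D (Avail-ren (C ∧ D) av le) (λ le' x _ → resume c le' x)) ,
      run D (mk λ le G c → use∧ C D (Avail-ren (C ∧ D) av le) (λ le' _ y → resume c le' y))
    reflect (C ∨ D) av = mk λ le G c →
      use∨ C D (Avail-ren (C ∨ D) av le) (λ le' v → resume-with (Either-stable C D) c le' v)
    reflect (C ⇒ D) av le x = reflect⇒ C D (Avail-ren (C ⇒ D) av le) x
    reflect (∀' C) {ρ} av {k} le t = run C (mk λ {k2} le2 G c →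
      use∀ C (Avail-ren (∀' C) (Avail-ren (∀' C) av le) le2) (substT (sh k2) t)
        (λ le' x → resume {σ = ren k2 (t ∷ₛ ren k ρ)} c le'
                     (cast C (ext λ { zero → refl ; (suc n) → refl }) x)))
    reflect (∃' C) av = mk λ le G c → use∃ C (Avail-ren (∃' C) av le) c

    -- using available compound hypotheses: a member is decomposed by its left
    -- rule, a derived one already provides its components
    use∧ : ∀ C D {σ Δ G} → Avail Δ (subst σ C ∧ subst σ D) →
           (∀ {Δ'} → Δ ≤[ 0 ] Δ' → ⟦ C ⟧ σ Δ' → ⟦ D ⟧ σ Δ' → Δ' ⊢ G) → Δ ⊢ G
    use∧ C D (mem h) k with extract h
    ... | Γ , q = unperm q (∧L (k (≤-replace₂ q (via∧ (mem (here refl)) (mem (there (here refl)))))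
                                  (reflect C (mem (here refl))) (reflect D (mem (there (here refl))))))
    use∧ C D (via∧ a b) k = k ≤-refl (reflect C a) (reflect D b)

    use∨ : ∀ C D {σ Δ G} → Avail Δ (subst σ C ∨ subst σ D) →
           (∀ {Δ'} → Δ ≤[ 0 ] Δ' → Either C D σ Δ' → Δ' ⊢ G) → Δ ⊢ G
    use∨ C D (mem h) k with extract h
    ... | Γ , q = unperm q (∨L (k (≤-replace q (via∨₁ (mem (here refl)))) (inj₁ (reflect C (mem (here refl)))))
                               (k (≤-replace q (via∨₂ (mem (here refl)))) (inj₂ (reflect D (mem (here refl))))))
    use∨ C D (via∨₁ a) k = k ≤-refl (inj₁ (reflect C a))
    use∨ C D (via∨₂ b) k = k ≤-refl (inj₂ (reflect D b))

    use∃ : ∀ C {σ Δ G} → Avail Δ (∃' (subst (exts σ) C)) →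
           (∀ {k Δ'} → Δ ≤[ k ] Δ' → Witnessed C (ren k σ) Δ' → Δ' ⊢ shiftBy k G) → Δ ⊢ G
    use∃ C {σ} (mem h) c with extract h
    ... | Γ , q = unperm q (∃L (c opened (var zero , reflect C (mem (here (sym (exts-fresh σ C)))))))
      where
        opened : _ ≤[ 1 ] (subst (exts σ) C ∷ shiftCtx Γ)
        opened h' with ∈-resp-↭ q h'
        ... | here refl = via∃ (var zero) (mem (here (sym (inst-fresh-shift (subst (exts σ) C)))))
        ... | there h'' = mem (there (∈-map⁺ shift h''))
    use∃ C {σ} (via∃ t a) c =
      resume-with (Witnessed-stable C) c ≤-refl (t , reflect C (tr (Avail _) (inst-exts σ t C) a))

    use∀ : ∀ C {σ Δ G} → Avail Δ (∀' (subst (exts σ) C)) → ∀ t →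
           (∀ {Δ'} → Δ ≤[ 0 ] Δ' → ⟦ C ⟧ (t ∷ₛ σ) Δ' → Δ' ⊢ G) → Δ ⊢ G
    use∀ C {σ} (mem h) t k with extract h
    ... | Γ , q = unperm q (∀L t (k (≤-replace₂ q (mem (there (here refl))))
                                    (reflect C (mem (here (sym (inst-subst σ t C)))))))

    reflect⇒ : ∀ X Y {ρ Δ} → Avail Δ (subst ρ X ⇒ subst ρ Y) → ⟦ X ⟧ ρ Δ → ⟦ Y ⟧ ρ Δ
    reflect⇒ X Y av x = run Y (mk λ le G c → apply-avail X Y (Avail-ren (X ⇒ Y) av le) (mono X x le) G c)

    apply-avail : ∀ X Y {σ Δ} → Avail Δ (subst σ X ⇒ subst σ Y) → ⟦ X ⟧ σ Δ → ∀ G → Kont Y σ Δ G → Δ ⊢ G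
    apply-avail X Y av x G c = avail⇒-cases X Y av (λ h → leftRule X Y h x G c) (λ f → resume c ≤-refl (f x))

    -- an available implication is a member, or is derived and then holds semantically
    -- (by recursion on the smaller implications it was derived from)
    avail⇒-cases : ∀ X Y {ρ Δ} {R : Set} → Avail Δ (subst ρ X ⇒ subst ρ Y) →
                   ((subst ρ X ⇒ subst ρ Y) ∈ Δ → R) → ((⟦ X ⟧ ρ Δ → ⟦ Y ⟧ ρ Δ) → R) → R
    avail⇒-cases (C ∧ D) Y (via⇒∧₁ a) m s = s (λ x → reflect⇒ C Y a (proj₁ x))
    avail⇒-cases (C ∧ D) Y (via⇒∧₂ a) m s = s (λ x → reflect⇒ D Y a (proj₂ x))
    avail⇒-cases (C ∨ D) Y (via⇒∨ a b) m s = s (λ x → M-bind (Either-stable C D) Y x λ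
      { le (inj₁ c) → reflect⇒ C Y (Avail-ren (C ⇒ Y) a le) c
      ; le (inj₂ d) → reflect⇒ D Y (Avail-ren (D ⇒ Y) b le) d })
    avail⇒-cases (C ⇒ D) Y (via⇒⇒ a b) m s = s (λ x → reflect⇒ D Y b (⇒-elim C D x (reflect C a)))
    avail⇒-cases X Y (mem h) m s = m h
    avail⇒-cases X Y (viaB b) m s = s (λ _ → reflect Y b)

    continue : ∀ Y {σ Δ G X' Γ} → Kont Y σ Δ G → Δ ↭ (X' ⇒ subst σ Y) ∷ Γ → (subst σ Y ∷ Γ) ⊢ G
    continue Y c q = resume c (≤-replace q (viaB (mem (here refl)))) (reflect Y (mem (here refl)))

    leftRule : ∀ X Y {σ Δ} → (subst σ X ⇒ subst σ Y) ∈ Δ → ⟦ X ⟧ σ Δ → ∀ G → Kont Y σ Δ G → Δ ⊢ G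
    leftRule X Y h x G c = leftRuleBy implicationLeft X Y h x G c

    leftRuleBy : ImplicationLeft _⊢_ →
                 ∀ X Y {σ Δ} → (subst σ X ⇒ subst σ Y) ∈ Δ → ⟦ X ⟧ σ Δ → ∀ G → Kont Y σ Δ G → Δ ⊢ G
    leftRuleBy (kleene ⇒L) X Y h x G c with extract h
    ... | Γ , q = unperm q (⇒L (perm q (reify X x)) (continue Y c q))
    leftRuleBy (dyckhoff r) X Y h x G c = dyckhoffRule r X Y h x G c

    dyckhoffRule : DyckhoffRules _⊢_ →
                   ∀ X Y {σ Δ} → (subst σ X ⇒ subst σ Y) ∈ Δ → ⟦ X ⟧ σ Δ → ∀ G → Kont Y σ Δ G → Δ ⊢ G
    dyckhoffRule r (atom p ts) Y h x G c =
      force-then (Atom-stable p ts) (atom p ts) Y (reflect (atom p ts)) (dyckhoffAtom r Y) h x G c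
    dyckhoffRule r ⊤ Y h x G c with extract h
    ... | Γ , q = unperm q (⇒L⊤ r (continue Y c q))
    dyckhoffRule r ⊥ Y h x G c = runM x ≤-refl G (λ _ ())
    dyckhoffRule r (C ∧ D) Y {σ} h (xc , xd) G c with extract h
    ... | Γ , q = unperm q (⇒L∧ r
          (coe⊢ (subst-ren0 σ C) (reify C (mono C xc (≤-replace q (via⇒∧₁ (mem (here refl)))))))
          (coe⊢ (subst-ren0 σ D) (reify D (mono D xd (≤-replace q (via⇒∧₂ (mem (here refl)))))))
          (continue Y c q))
    dyckhoffRule r (C ∨ D) Y h x G c =
      force-then (Either-stable C D) (C ∨ D) Y (∨-from-Either C D) (dyckhoff∨ r C D Y) h x G c
    dyckhoffRule r (C ⇒ D) Y {σ} h x G c with extract h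
    ... | Γ , q = unperm q (⇒L⇒ r
          (coe⊢ (subst-ren0 σ D) (reify D (x (≤-replace₂ q (via⇒⇒ (mem (there (here refl))) (mem (here refl))))
                                               (reflect C (mem (there (here (subst-ren0 σ C))))))))
          (continue Y c q))
    dyckhoffRule r (∀' C) Y {σ} h x G c with extract h
    ... | Γ , q = unperm q (⇒L∀ r (coe⊢ (sym (exts-fresh σ C)) (reify C (x (≤-fresh q) (var zero))))
                                  (continue Y c q))
    dyckhoffRule r (∃' C) Y h x G c =
      force-then (Witnessed-stable C) (∃' C) Y (λ (t , a) → ∃-intro C t a) (dyckhoff∃ r C Y) h x G c

    -- For atoms, disjunctions and existentials the antecedent's value is forced
    -- first; in the resulting world the implication is either still a member,
    -- handled by `use`, or has become derivable and is applied semantically.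
    force-then : ∀ {S} → Stable S → ∀ X Y {σ Δ} →
                 (∀ {σ' Δ'} → S σ' Δ' → ⟦ X ⟧ σ' Δ') →
                 (∀ {σ' Δ' G'} → (subst σ' X ⇒ subst σ' Y) ∈ Δ' → S σ' Δ' → Kont Y σ' Δ' G' → Δ' ⊢ G') →
                 (subst σ X ⇒ subst σ Y) ∈ Δ → M S σ Δ → ∀ G → Kont Y σ Δ G → Δ ⊢ G
    force-then st X Y {σ} value use h x G c = runM x ≤-refl G λ {k} le s →
      let s′ = st (ren-ext k (ren0 σ)) s
          c′ = Kont-mono {Y} {σ} c le
      in avail⇒-cases X Y {ren k σ} (Avail-ren (X ⇒ Y) (mem h) le)
           (λ h′ → use h′ s′ c′)
           (λ f → resume c′ ≤-refl (f (value s′)))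

    -- p ⇒ Y is used by ⇒Lax once the atom p is available (hence a member)
    dyckhoffAtom : DyckhoffRules _⊢_ → ∀ Y {σ Δ G p us} →
                   (atom p us ⇒ subst σ Y) ∈ Δ → Avail Δ (atom p us) → Kont Y σ Δ G → Δ ⊢ G
    dyckhoffAtom r Y h (mem ha) c with extract h
    ... | Γ , q with ∈-resp-↭ q ha
    ... | there ha' with extract ha'
    ... | Γ' , q' = unperm q″ (⇒Lax r (resume c atom-kept (reflect Y (mem (there (here refl))))))
      where
        q″ = ↭-trans q (↭-trans (prep _ q') (swap _ _ ↭-refl))
        atom-kept = ≤-step q″ (λ { (here refl) → mem (here refl)
                                 ; (there (here refl)) → viaB (mem (there (here refl)))
                                 ; (there (there h')) → mem (there (there h')) })

    dyckhoff∨ : DyckhoffRules _⊢_ → ∀ C D Y {σ Δ G} →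
                (subst σ (C ∨ D) ⇒ subst σ Y) ∈ Δ → Either C D σ Δ → Kont Y σ Δ G → Δ ⊢ G
    dyckhoff∨ r C D Y {σ} h (inj₁ a) c with extract h
    ... | Γ , q = unperm q (⇒L∨₁ r (coe⊢ (subst-ren0 σ C) (reify C (mono C a (≤-split∨ q)))) (continue Y c q))
    dyckhoff∨ r C D Y {σ} h (inj₂ b) c with extract h
    ... | Γ , q = unperm q (⇒L∨₂ r (coe⊢ (subst-ren0 σ D) (reify D (mono D b (≤-split∨ q)))) (continue Y c q))

    dyckhoff∃ : DyckhoffRules _⊢_ → ∀ C Y {σ Δ G} →
                (subst σ (∃' C) ⇒ subst σ Y) ∈ Δ → Witnessed C σ Δ → Kont Y σ Δ G → Δ ⊢ G
    dyckhoff∃ r C Y {σ} h (t , a) c with extract h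
    ... | Γ , q = unperm q (⇒L∃ r t (perm q (coe⊢ (sym (inst-subst σ t C)) (reify C a))) (continue Y c q))

  complete : ∀ {Γ G} → Γ ⊨ G → Γ ⊢ G
  complete {Γ} {G} s = coe⊢ (subst-id G) (reify G {var}
    (s (tabulate λ {H} h → reflect H {var} (mem (tr (_∈ Γ) (sym (subst-id H)) h)))))

-- A D-derivation is valid in the model whose continuations answer
-- with K-derivations, and K is complete for that model; symmetrically, a
-- K-derivation is valid in the model answering in D, for which D is complete.
theorem6 : (Γ : Ctx) (G : Prop) → (Γ ⊢D G → Γ ⊢K G) × (Γ ⊢K G → Γ ⊢D G)
theorem6 Γ G = D⇒K , K⇒D
  where
    D⇒K : Γ ⊢D G → Γ ⊢K G
    D⇒K d = Completeness.complete _⊢K_ K-common (kleene K-kleene) (Soundness.D-sound _⊢K_ d)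

    K⇒D : Γ ⊢K G → Γ ⊢D G
    K⇒D d = Completeness.complete _⊢D_ D-common (dyckhoff D-dyckhoff) (Soundness.K-sound _⊢D_ d)
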